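{- If $G$ is a proper circular-arc graph with non-bipartite complement, then every arc ordering of the closed neighborhood hypergraph $\mathcal{N}[G]$ is tight.
   Context: $\mathcal{N}[G]$ is the hypergraph on $V(G)$ whose hyperedges are the closed neighborhoods $N[v]=\{v\}\cup\{u: uv\in E(G)\}$. A PCA graph is one having a representation by arcs of a circle, adjacency meaning intersection, in which no arc is contained in another. An arc ordering of a hypergraph on vertex set $V$ is a circular ordering of $V$ in which every hyperedge is an arc (set of circularly consecutive vertices); it is tight if for any hyperedges $A,B$ with $\emptyset\ne A\subseteq B\ne V$ the arcs $A$ and $B$ share an endpoint. -}

module Defs where

open import Data.Nat using (ℕ; zero; suc; _+_; _∸_; _≤_; _<_; _≤?_)
open import Data.Fin using (Fin; toℕ)
open import Data.Bool using (Bool; true; false)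
open import Data.Product using (Σ; ∃; ∃-syntax; _×_; _,_)
open import Data.Sum using (_⊎_)
open import Relation.Nullary using (¬_; yes; no)
open import Relation.Binary.PropositionalEquality using (_≡_; _≢_)
open import Function.Bundles using (_⇔_)
open import Function.Definitions using (Injective)

record Graph (n : ℕ) : Set where
  field
    adj   : Fin n → Fin n → Bool
    sym   : ∀ u v → adj u v ≡ adj v u
    irrefl : ∀ v → adj v v ≡ false
open Graph public

Subset : ℕ → Set
Subset n = Fin n → Bool

_∈_ : ∀ {n} → Fin n → Subset n → Set
v ∈ A = A v ≡ true

_⊆_ : ∀ {n} → Subset n → Subset n → Set
A ⊆ B = ∀ v → v ∈ A → v ∈ B

Nonempty : ∀ {n} → Subset n → Set
Nonempty A = ∃[ v ] v ∈ A

IsFull : ∀ {n} → Subset n → Set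
IsFull A = ∀ v → v ∈ A

data InClosedNbhd {n} (G : Graph n) (v : Fin n) (u : Fin n) : Set where
  self : u ≡ v → InClosedNbhd G v u
  nbr  : adj G v u ≡ true → InClosedNbhd G v u

Hypergraph : ℕ → Set₁
Hypergraph n = Subset n → Set

𝒩[_] : ∀ {n} → Graph n → Hypergraph n
𝒩[ G ] A = ∃[ v ] (∀ u → (u ∈ A) ⇔ InClosedNbhd G v u)

offset : (m : ℕ) → Fin m → Fin m → ℕ
offset m s p with toℕ s ≤? toℕ p
... | yes _ = toℕ p ∸ toℕ s
... | no  _ = (m ∸ toℕ s) + toℕ p

-- Circular orderings of Fin n and arcs in them.
-- A circular ordering is given by an injective (hence bijective)
-- position map pos : Fin n → Fin n.

ArcAt : ∀ {n} → (Fin n → Fin n) → Subset n → Fin n → ℕ → Set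
ArcAt {n} pos A s l = (l ≤ n) × (∀ v → (v ∈ A) ⇔ (offset n s (pos v) < l))

IsArc : ∀ {n} → (Fin n → Fin n) → Subset n → Set
IsArc pos A = ∃[ s ] ∃[ l ] ArcAt pos A s l

IsEndpoint : ∀ {n} → (Fin n → Fin n) → Subset n → Fin n → Set
IsEndpoint {n} pos A v =
  ∃[ s ] ∃[ l ] (ArcAt pos A s l × (1 ≤ l) ×
    ((offset n s (pos v) ≡ 0) ⊎ (suc (offset n s (pos v)) ≡ l)))

IsArcOrdering : ∀ {n} → Hypergraph n → (Fin n → Fin n) → Set
IsArcOrdering H pos = Injective _≡_ _≡_ pos × (∀ A → H A → IsArc pos A)

IsTight : ∀ {n} → Hypergraph n → (Fin n → Fin n) → Set
IsTight H pos = ∀ A B → H A → H B → Nonempty A → A ⊆ B → ¬ IsFull B →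
  ∃[ v ] (IsEndpoint pos A v × IsEndpoint pos B v)

record CircArc (m : ℕ) : Set where
  constructor arc
  field
    start : Fin m
    len   : ℕ
    len≥1 : 1 ≤ len
    len≤m : len ≤ m
open CircArc public

OnArc : ∀ {m} → CircArc m → Fin m → Set
OnArc {m} a p = offset m (start a) p < len a

Intersect : ∀ {m} → CircArc m → CircArc m → Set
Intersect a b = ∃[ p ] (OnArc a p × OnArc b p)

ArcContained : ∀ {m} → CircArc m → CircArc m → Set
ArcContained a b = ∀ p → OnArc a p → OnArc b p

record PCAModel {n} (G : Graph n) : Set where
  field
    m       : ℕ
    arcOf   : Fin n → CircArc m
    adj⇔int : ∀ u v → u ≢ v → (adj G u v ≡ true) ⇔ Intersect (arcOf u) (arcOf v)
    proper  : ∀ u v → u ≢ v → ¬ ArcContained (arcOf u) (arcOf v)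

IsPCA : ∀ {n} → Graph n → Set
IsPCA G = PCAModel G

ComplAdj : ∀ {n} → Graph n → Fin n → Fin n → Set
ComplAdj G u v = (u ≢ v) × (adj G u v ≡ false)

IsBipartiteComplement : ∀ {n} → Graph n → Set
IsBipartiteComplement {n} G =
  Σ (Fin n → Bool) λ c → ∀ u v → ComplAdj G u v → c u ≢ c v

-- Let hyperedges A = N[u] ⊆ B = N[v] ≠ V share no endpoint, so that the arc A lies strictly
-- inside the arc B.  Read the circle linearly from the first vertex of B, or backwards from its
-- last one, so that u comes before v.  A vertex of B on either side of A is adjacent to v and to a
-- vertex before u but not to u, so its arc wraps around: it is adjacent to everything from v on.
-- Hence, if z is the last vertex between v and the end of A with a non-neighbour outside B and z′
-- is its successor, every vertex is adjacent to z or to z′.  Cutting the circle between z and z′,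
-- colour each vertex by whether it has a non-neighbour further along: non-adjacent vertices get
-- different colours, so the complement of G is bipartite.

module Submission where

open import Defs hiding (sym)
open import Data.Nat using (ℕ; zero; suc; _+_; _∸_; _≤_; _<_; _≰_; z≤n; s≤s; s≤s⁻¹; s<s⁻¹)
open import Data.Nat.Properties
open import Data.Fin using (Fin; toℕ; fromℕ<; punchOut) renaming (_≟_ to _≟ᶠ_)
open import Data.Fin.Properties using (toℕ<n; toℕ-injective; fromℕ<-injective; any?; punchOut-injective; injective⇒≤)
open import Data.Bool using (Bool; true; false)
open import Data.Bool.Properties using (T-≡)
open import Data.Product using (∃; ∃₂; ∃-syntax; _×_; _,_; proj₁; proj₂)
open import Data.Sum using (_⊎_; inj₁; inj₂; [_,_]′)
open import Data.Empty using (⊥; ⊥-elim)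
open import Function using (_∘_)
open import Function.Bundles using (_⇔_; mk⇔; Equivalence)
open import Function.Definitions using (Injective)
open import Function.Construct.Composition using (_⇔-∘_)
open import Function.Construct.Symmetry using (⇔-sym)
open import Relation.Nullary using (¬_; Dec; yes; no; does; contradiction)
open import Relation.Nullary.Decidable using (_×-dec_; ¬?; isYes; toWitness; fromWitness; dec-true; dec-false)
open import Relation.Binary using (Tri; tri<; tri≈; tri>)
open import Relation.Binary.PropositionalEquality using (_≡_; _≢_; ≢-sym; refl; sym; trans; cong; subst; subst₂; module ≡-Reasoning)
open import Algebra.Properties.CommutativeSemigroup +-commutativeSemigroup using (xy∙z≈y∙xz; xy∙z≈xz∙y)

open Equivalence using (to; from)

private
  variable
    n : ℕ

injective⇒surjective : {f : Fin n → Fin n} → Injective _≡_ _≡_ f → ∀ y → ∃ λ x → f x ≡ y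
injective⇒surjective {zero} _ ()
injective⇒surjective {suc n} {f} f-injective y with any? (λ x → f x ≟ᶠ y)
... | yes hit = hit
... | no miss = contradiction (injective⇒≤ punchOut-y∘f-injective) 1+n≰n
  where
  y≢f : ∀ x → y ≢ f x
  y≢f x y≡fx = miss (x , sym y≡fx)
  punchOut-y∘f-injective : Injective _≡_ _≡_ (λ x → punchOut (y≢f x))
  punchOut-y∘f-injective eq = f-injective (punchOut-injective (y≢f _) (y≢f _) eq)

maximal-witness : {P : ℕ → Set} → (∀ k → Dec (P k)) → ∀ {k} γ → k ≤ γ → P k →
  ∃ λ q → k ≤ q × q ≤ γ × P q × (q ≡ γ ⊎ ¬ P (suc q))
maximal-witness P? zero k≤0 Pk = _ , ≤-refl , k≤0 , Pk , inj₁ (n≤0⇒n≡0 k≤0)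
maximal-witness {P} P? (suc γ) k≤1+γ Pk with P? (suc γ) | m≤n⇒m<n∨m≡n k≤1+γ
... | yes P[1+γ] | _ = suc γ , k≤1+γ , ≤-refl , P[1+γ] , inj₁ refl
... | no ¬P[1+γ] | inj₂ k≡1+γ = contradiction (subst P k≡1+γ Pk) ¬P[1+γ]
... | no ¬P[1+γ] | inj₁ k<1+γ with maximal-witness P? γ (s≤s⁻¹ k<1+γ) Pk
...   | q , k≤q , q≤γ , Pq , inj₁ refl = q , k≤q , m≤n⇒m≤1+n q≤γ , Pq , inj₂ ¬P[1+γ]
...   | q , k≤q , q≤γ , Pq , inj₂ ¬P[1+q] = q , k≤q , m≤n⇒m≤1+n q≤γ , Pq , inj₂ ¬P[1+q]

WrapsTo : ℕ → ℕ → ℕ → Set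
WrapsTo n a b = a ≡ b ⊎ a ≡ b + n

wrapsTo-functional : ∀ {a b c} → b < n → c < n → WrapsTo n a b → WrapsTo n a c → b ≡ c
wrapsTo-functional _ _ (inj₁ a≡b) (inj₁ a≡c) = trans (sym a≡b) a≡c
wrapsTo-functional {n} {b = b} {c} _ _ (inj₂ a≡b+n) (inj₂ a≡c+n) = +-cancelʳ-≡ n b c (trans (sym a≡b+n) a≡c+n)
wrapsTo-functional {n} {b = b} {c} b<n _ (inj₁ a≡b) (inj₂ a≡c+n) =
  contradiction (subst (n ≤_) (trans (sym a≡c+n) a≡b) (m≤n+m n c)) (<⇒≱ b<n)
wrapsTo-functional {n} {b = b} {c} _ c<n (inj₂ a≡b+n) (inj₁ a≡c) =
  contradiction (subst (n ≤_) (trans (sym a≡b+n) a≡c) (m≤n+m n b)) (<⇒≱ c<n)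

+-shift : ∀ z A {C} m → z + A ≡ C → z + m + A ≡ C + m
+-shift z A m z+A≡C = trans (xy∙z≈xz∙y z m A) (cong (_+ m) z+A≡C)

wrapsTo-cancelʳ : ∀ {x z A C} → x < n + n → z < n → WrapsTo n (z + A) C →
  x + A ≡ C ⊎ x + A ≡ C + n ⊎ x + A ≡ C + n + n → WrapsTo n x z
wrapsTo-cancelʳ {n} {x} {z} {A} _ _ (inj₁ z+A≡C) (inj₁ x+A≡C) =
  inj₁ (+-cancelʳ-≡ A x z (trans x+A≡C (sym z+A≡C)))
wrapsTo-cancelʳ {n} {x} {z} {A} _ _ (inj₁ z+A≡C) (inj₂ (inj₁ x+A≡C+n)) =
  inj₂ (+-cancelʳ-≡ A x (z + n) (trans x+A≡C+n (sym (+-shift z A n z+A≡C))))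
wrapsTo-cancelʳ {n} {x} {z} {A} x<2n _ (inj₁ z+A≡C) (inj₂ (inj₂ x+A≡C+n+n)) = contradiction
  (subst (n + n ≤_)
    (+-cancelʳ-≡ A (z + n + n) x (trans (+-shift (z + n) A n (+-shift z A n z+A≡C)) (sym x+A≡C+n+n)))
    (+-monoˡ-≤ n (m≤n+m n z)))
  (<⇒≱ x<2n)
wrapsTo-cancelʳ {n} {x} {z} {A} _ z<n (inj₂ z+A≡C+n) (inj₁ x+A≡C) = contradiction
  (subst (n ≤_) (+-cancelʳ-≡ A (x + n) z (trans (+-shift x A n x+A≡C) (sym z+A≡C+n))) (m≤n+m n x))
  (<⇒≱ z<n)
wrapsTo-cancelʳ {n} {x} {z} {A} _ _ (inj₂ z+A≡C+n) (inj₂ (inj₁ x+A≡C+n)) =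
  inj₁ (+-cancelʳ-≡ A x z (trans x+A≡C+n (sym z+A≡C+n)))
wrapsTo-cancelʳ {n} {x} {z} {A} _ _ (inj₂ z+A≡C+n) (inj₂ (inj₂ x+A≡C+n+n)) =
  inj₂ (+-cancelʳ-≡ A x (z + n) (trans x+A≡C+n+n (sym (+-shift z A n z+A≡C+n))))

offset<n : (s p : Fin n) → offset n s p < n
offset<n {n} s p with toℕ s ≤? toℕ p
... | yes _  = ≤-<-trans (m∸n≤m (toℕ p) (toℕ s)) (toℕ<n p)
... | no s≰p = begin-strict
  n ∸ toℕ s + toℕ p  <⟨ +-monoʳ-< (n ∸ toℕ s) (≰⇒> s≰p) ⟩
  n ∸ toℕ s + toℕ s  ≡⟨ m∸n+n≡m (<⇒≤ (toℕ<n s)) ⟩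
  n                  ∎
  where open ≤-Reasoning

offset-self : (p : Fin n) → offset n p p ≡ 0
offset-self p with toℕ p ≤? toℕ p
... | yes _   = n∸n≡0 (toℕ p)
... | no p≰p = contradiction ≤-refl p≰p

offset-wraps : (s p : Fin n) → WrapsTo n (offset n s p + toℕ s) (toℕ p)
offset-wraps {n} s p with toℕ s ≤? toℕ p
... | yes s≤p = inj₁ (m∸n+n≡m s≤p)
... | no _    = inj₂ (begin
  n ∸ toℕ s + toℕ p + toℕ s    ≡⟨ xy∙z≈y∙xz (n ∸ toℕ s) (toℕ p) (toℕ s) ⟩
  toℕ p + (n ∸ toℕ s + toℕ s)  ≡⟨ cong (toℕ p +_) (m∸n+n≡m (<⇒≤ (toℕ<n s))) ⟩
  toℕ p + n                    ∎)
  where open ≡-Reasoning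

offset-injectiveʳ : (s : Fin n) {p q : Fin n} → offset n s p ≡ offset n s q → p ≡ q
offset-injectiveʳ {n} s {p} {q} eq = toℕ-injective (wrapsTo-functional (toℕ<n p) (toℕ<n q)
  (offset-wraps s p) (subst (λ o → WrapsTo n (o + toℕ s) (toℕ q)) (sym eq) (offset-wraps s q)))

offset-trans : (a b c : Fin n) → WrapsTo n (offset n a b + offset n b c) (offset n a c)
offset-trans {n} a b c = wrapsTo-cancelʳ (+-mono-< (offset<n a b) (offset<n b c)) (offset<n a c)
  (offset-wraps a c) (via-b (offset-wraps a b) (offset-wraps b c))
  where
  x = offset n a b
  y = offset n b c
  shift : ∀ {P} → x + toℕ a ≡ P → x + y + toℕ a ≡ y + P
  shift eq = trans (xy∙z≈y∙xz x y (toℕ a)) (cong (y +_) eq)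
  via-b : WrapsTo n (x + toℕ a) (toℕ b) → WrapsTo n (y + toℕ b) (toℕ c) →
    x + y + toℕ a ≡ toℕ c ⊎ x + y + toℕ a ≡ toℕ c + n ⊎ x + y + toℕ a ≡ toℕ c + n + n
  via-b (inj₁ ab) (inj₁ bc) = inj₁ (trans (shift ab) bc)
  via-b (inj₁ ab) (inj₂ bc) = inj₂ (inj₁ (trans (shift ab) bc))
  via-b (inj₂ ab) (inj₁ bc) = inj₂ (inj₁ (trans (shift ab) (trans (sym (+-assoc y (toℕ b) n)) (cong (_+ n) bc))))
  via-b (inj₂ ab) (inj₂ bc) = inj₂ (inj₂ (trans (shift ab) (trans (sym (+-assoc y (toℕ b) n)) (cong (_+ n) bc))))

offset-injectiveˡ : (s : Fin n) {p q : Fin n} → offset n p s ≡ offset n q s → p ≡ q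
offset-injectiveˡ {n} s {p} {q} eq with offset-trans p q s
... | inj₁ e = sym (offset-injectiveʳ p
  (trans (+-cancelʳ-≡ (offset n q s) (offset n p q) 0 (trans e eq)) (sym (offset-self p))))
... | inj₂ e = contradiction
  (+-cancelʳ-≡ (offset n q s) (offset n p q) n (trans e (trans (cong (_+ n) eq) (+-comm _ n))))
  (<⇒≢ (offset<n p q))

-- Reading the arc that starts at s from a base point b, positions are ordered by k = offset n b;
-- their offsets f from s are k shifted by offset n s b, and a position is Wrapped when that shift
-- passes the end of the cycle.
module ForwardView (s b : Fin n) where
  private
    k f : Fin n → ℕ
    k = offset n b
    f = offset n s

    Unwrapped Wrapped : Fin n → Set
    Unwrapped p = offset n s b + k p ≡ f p
    Wrapped   p = offset n s b + k p ≡ f p + n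

    unwrapped-or-wrapped : ∀ p → Unwrapped p ⊎ Wrapped p
    unwrapped-or-wrapped = offset-trans s b

    wrapped-before-unwrapped : ∀ {p q} → k p < k q → Wrapped p → Unwrapped q → ⊥
    wrapped-before-unwrapped {p} {q} p<q wp uq = <⇒≱ (offset<n s q) (begin
      n                   ≤⟨ m≤n+m n (f p) ⟩
      f p + n             ≡⟨ sym wp ⟩
      offset n s b + k p  ≤⟨ +-monoʳ-≤ (offset n s b) (<⇒≤ p<q) ⟩
      offset n s b + k q  ≡⟨ uq ⟩
      f q                 ∎)
      where open ≤-Reasoning

    unwrapped-monotone : ∀ {p q} → Unwrapped p → Unwrapped q → k p < k q → f p < f q
    unwrapped-monotone up uq p<q = subst₂ _<_ up uq (+-monoʳ-< (offset n s b) p<q)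

    wrapped-monotone : ∀ {p q} → Wrapped p → Wrapped q → k p < k q → f p < f q
    wrapped-monotone {p} {q} wp wq p<q =
      +-cancelʳ-< n (f p) (f q) (subst₂ _<_ wp wq (+-monoʳ-< (offset n s b) p<q))

    wrapped<unwrapped : ∀ {p q} → Wrapped p → Unwrapped q → f p < f q
    wrapped<unwrapped {p} {q} wp uq = begin-strict
      f p                 <⟨ +-cancelʳ-< n (f p) (offset n s b) (begin-strict
        f p + n             ≡⟨ sym wp ⟩
        offset n s b + k p  <⟨ +-monoʳ-< (offset n s b) (offset<n b p) ⟩
        offset n s b + n    ∎) ⟩
      offset n s b        ≤⟨ m≤m+n (offset n s b) (k q) ⟩
      offset n s b + k q  ≡⟨ uq ⟩
      f q                 ∎
      where open ≤-Reasoning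

  arc-wraps : ∀ {l a m d w} → k a < k m → k m < k d → f a < l → f d < l → ¬ f m < l →
    k w < k a ⊎ k d < k w → f w < l
  arc-wraps {a = a} {m} {d} {w} a<m m<d a∈ d∈ m∉ outside
    with unwrapped-or-wrapped m | unwrapped-or-wrapped d
  ... | inj₁ um | inj₁ ud = contradiction (<-trans (unwrapped-monotone um ud m<d) d∈) m∉
  ... | inj₂ wm | inj₂ wd = contradiction (<-trans (wrapped-monotone wm wd m<d) d∈) m∉
  ... | inj₂ wm | inj₁ ud = ⊥-elim (wrapped-before-unwrapped m<d wm ud)
  ... | inj₁ um | inj₂ wd with unwrapped-or-wrapped a | outside | unwrapped-or-wrapped w
  ...   | inj₂ wa | _        | _      = ⊥-elim (wrapped-before-unwrapped a<m wa um)
  ...   | inj₁ ua | inj₁ w<a | inj₁ uw = <-trans (unwrapped-monotone uw ua w<a) a∈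
  ...   | inj₁ ua | inj₁ w<a | inj₂ ww = ⊥-elim (wrapped-before-unwrapped w<a ww ua)
  ...   | inj₁ ua | inj₂ d<w | inj₁ uw = ⊥-elim (wrapped-before-unwrapped d<w wd uw)
  ...   | inj₁ ua | inj₂ d<w | inj₂ ww = <-trans (wrapped<unwrapped ww ua) a∈

-- Reading backwards from b (k = distance to b), the offsets f from s decrease with k, except for
-- one jump upwards at the Wrapped positions, which come last.
module BackwardView (s b : Fin n) where
  private
    k f : Fin n → ℕ
    k p = offset n p b
    f = offset n s

    Unwrapped Wrapped : Fin n → Set
    Unwrapped p = f p + k p ≡ offset n s b
    Wrapped   p = f p + k p ≡ offset n s b + n

    unwrapped-or-wrapped : ∀ p → Unwrapped p ⊎ Wrapped p
    unwrapped-or-wrapped p = offset-trans s p b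

    wrapped-before-unwrapped : ∀ {p q} → k p < k q → Wrapped p → Unwrapped q → ⊥
    wrapped-before-unwrapped {p} {q} p<q wp uq = <-irrefl refl (begin-strict
      offset n s b + n  ≡⟨ sym wp ⟩
      f p + k p         <⟨ +-mono-< (offset<n s p) p<q ⟩
      n + k q           ≤⟨ +-monoʳ-≤ n (subst (k q ≤_) uq (m≤n+m (k q) (f q))) ⟩
      n + offset n s b  ≡⟨ +-comm n (offset n s b) ⟩
      offset n s b + n  ∎)
      where open ≤-Reasoning

    antitone : ∀ {p q t} → f p + k p ≡ t → f q + k q ≡ t → k p < k q → f q < f p
    antitone {p} {q} p↦t q↦t p<q = +-cancelʳ-< (k q) (f q) (f p) (begin-strict
      f q + k q  ≡⟨ trans q↦t (sym p↦t) ⟩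
      f p + k p  <⟨ +-monoʳ-< (f p) p<q ⟩
      f p + k q  ∎)
      where open ≤-Reasoning

    unwrapped<wrapped : ∀ {p q} → Unwrapped p → Wrapped q → f p < f q
    unwrapped<wrapped {p} {q} up wq = begin-strict
      f p           ≤⟨ subst (f p ≤_) up (m≤m+n (f p) (k p)) ⟩
      offset n s b  <⟨ +-cancelʳ-< (k q) (offset n s b) (f q) (begin-strict
        offset n s b + k q  <⟨ +-monoʳ-< (offset n s b) (offset<n q b) ⟩
        offset n s b + n    ≡⟨ sym wq ⟩
        f q + k q           ∎) ⟩
      f q           ∎
      where open ≤-Reasoning

  arc-wraps : ∀ {l a m d w} → k a < k m → k m < k d → f a < l → f d < l → ¬ f m < l →
    k w < k a ⊎ k d < k w → f w < l
  arc-wraps {a = a} {m} {d} {w} a<m m<d a∈ d∈ m∉ outside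
    with unwrapped-or-wrapped a | unwrapped-or-wrapped m
  ... | inj₁ ua | inj₁ um = contradiction (<-trans (antitone ua um a<m) a∈) m∉
  ... | inj₂ wa | inj₂ wm = contradiction (<-trans (antitone wa wm a<m) a∈) m∉
  ... | inj₂ wa | inj₁ um = ⊥-elim (wrapped-before-unwrapped a<m wa um)
  ... | inj₁ ua | inj₂ wm with unwrapped-or-wrapped d | outside | unwrapped-or-wrapped w
  ...   | inj₁ ud | _        | _      = ⊥-elim (wrapped-before-unwrapped m<d wm ud)
  ...   | inj₂ wd | inj₁ w<a | inj₁ uw = <-trans (unwrapped<wrapped uw wd) d∈
  ...   | inj₂ wd | inj₁ w<a | inj₂ ww = ⊥-elim (wrapped-before-unwrapped w<a ww ua)
  ...   | inj₂ wd | inj₂ d<w | inj₁ uw = ⊥-elim (wrapped-before-unwrapped d<w wd uw)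
  ...   | inj₂ wd | inj₂ d<w | inj₂ ww = <-trans (antitone wd ww d<w) d∈

module ClosedNeighbourhoods {n} (G : Graph n) where

  infix 4 _∈N[_] _∉N[_]

  _∈N[_] : Fin n → Fin n → Set
  w ∈N[ c ] = InClosedNbhd G c w

  _∉N[_] : Fin n → Fin n → Set
  w ∉N[ c ] = ¬ w ∈N[ c ]

  _∈N[_]? : ∀ w c → Dec (w ∈N[ c ])
  w ∈N[ c ]? with w ≟ᶠ c | adj G c w in c~w
  ... | yes w≡c | _     = yes (self w≡c)
  ... | no _    | true  = yes (nbr c~w)
  ... | no w≢c  | false = no λ where
    (self w≡c) → w≢c w≡c
    (nbr c~w′) → contradiction (trans (sym c~w) c~w′) λ ()

  ∈N[]-sym : ∀ {c w} → w ∈N[ c ] → c ∈N[ w ]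
  ∈N[]-sym (self w≡c)         = self (sym w≡c)
  ∈N[]-sym {c} {w} (nbr c~w) = nbr (trans (Graph.sym G w c) c~w)

  ∉N[]-sym : ∀ {c w} → w ∉N[ c ] → c ∉N[ w ]
  ∉N[]-sym w∉c c∈w = w∉c (∈N[]-sym c∈w)

  complAdj⇒∉N[] : ∀ {a c} → ComplAdj G a c → c ∉N[ a ]
  complAdj⇒∉N[] (a≢c , _)   (self c≡a) = a≢c (sym c≡a)
  complAdj⇒∉N[] (_ , a≁c) (nbr a~c)  = contradiction (trans (sym a≁c) a~c) λ ()

  -- rank b x is the place of x in a linear order of the vertices starting at b, in which every
  -- closed neighbourhood is an interval or the complement of one.
  record Ranking : Set where
    field
      rank           : Fin n → Fin n → ℕ
      rank<n         : ∀ b x → rank b x < n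
      rank-self      : ∀ b → rank b b ≡ 0
      rank-injective : ∀ b {x y} → rank b x ≡ rank b y → x ≡ y
      rank-trans     : ∀ b x y → WrapsTo n (rank b x + rank x y) (rank b y)
      nbhd-wraps     : ∀ b {c a m d} → rank b a < rank b m → rank b m < rank b d →
                       a ∈N[ c ] → d ∈N[ c ] → m ∉N[ c ] →
                       ∀ w → rank b w < rank b a ⊎ rank b d < rank b w → w ∈N[ c ]

    rank-surjective : ∀ b {k} → k < n → ∃ λ x → rank b x ≡ k
    rank-surjective b {k} k<n with injective⇒surjective bounded-rank-injective (fromℕ< k<n)
      where
      bounded-rank-injective : Injective _≡_ _≡_ (λ x → fromℕ< (rank<n b x))
      bounded-rank-injective {x} {y} =
        rank-injective b ∘ fromℕ<-injective (rank b x) (rank b y) (rank<n b x) (rank<n b y)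
    ... | x , eq = x , fromℕ<-injective (rank b x) k (rank<n b x) k<n eq

    rank-next⇒last : ∀ {b z z′} → rank b z′ ≡ suc (rank b z) → suc (rank z′ z) ≡ n
    rank-next⇒last {b} {z} {z′} z′-next with rank-trans b z′ z
    ... | inj₁ e = contradiction (≤-reflexive (trans (sym (cong (_+ rank z′ z) z′-next)) e))
                     (m+n≮m (rank b z) (rank z′ z))
    ... | inj₂ e = +-cancelˡ-≡ (rank b z) (suc (rank z′ z)) n
                     (trans (+-suc (rank b z) (rank z′ z)) (trans (sym (cong (_+ rank z′ z) z′-next)) e))

    rank≤last : ∀ {b z} → suc (rank b z) ≡ n → ∀ x → rank b x ≤ rank b z
    rank≤last {b} last x = s≤s⁻¹ (subst (rank b x <_) (sym last) (rank<n b x))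

  module _ (R : Ranking) where
    open Ranking R

    -- Of two non-adjacent vertices the later one has no non-neighbour t further along:
    -- otherwise its arc would miss both z and z′.
    consecutive-dominating-pair⇒bipartite-complement : ∀ {z z′} → suc (rank z′ z) ≡ n →
      (∀ w → w ∉N[ z ] → w ∉N[ z′ ] → ⊥) → IsBipartiteComplement G
    consecutive-dominating-pair⇒bipartite-complement {z} {z′} z-last dominating = colour , proper
      where
      K : Fin n → ℕ
      K = rank z′

      HasLaterNonNbr : Fin n → Set
      HasLaterNonNbr w = ∃ λ t → t ∉N[ w ] × K w < K t

      colour : Fin n → Bool
      colour w = does (any? λ t → ¬? (t ∈N[ w ]?) ×-dec (K w <? K t))

      later-has-no-later-nonNbr : ∀ {a c} → c ∉N[ a ] → K a < K c → ¬ HasLaterNonNbr c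
      later-has-no-later-nonNbr {a} {c} c∉a a<c (t , t∉c , c<t) = dominating c c∉N[z] c∉N[z′]
        where
        a∉c : a ∉N[ c ]
        a∉c = ∉N[]-sym c∉a

        c∉N[z′] : c ∉N[ z′ ]
        c∉N[z′] c∈z′ with m≤n⇒m<n∨m≡n (z≤n {K a})
        ... | inj₂ 0≡Ka = a∉c (subst (_∈N[ c ]) (rank-injective z′ (trans (rank-self z′) 0≡Ka)) (∈N[]-sym c∈z′))
        ... | inj₁ 0<Ka = t∉c (nbhd-wraps z′ (subst (_< K a) (sym (rank-self z′)) 0<Ka) a<c
                                  (∈N[]-sym c∈z′) (self refl) a∉c t (inj₂ c<t))

        c∉N[z] : c ∉N[ z ]
        c∉N[z] c∈z with m≤n⇒m<n∨m≡n (rank≤last z-last t)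
        ... | inj₂ Kt≡Kz = t∉c (subst (_∈N[ c ]) (rank-injective z′ (sym Kt≡Kz)) (∈N[]-sym c∈z))
        ... | inj₁ t<z   = a∉c (nbhd-wraps z′ c<t t<z (self refl) (∈N[]-sym c∈z) t∉c a (inj₁ a<c))

      colours-differ : ∀ {a c} → HasLaterNonNbr a → ¬ HasLaterNonNbr c → colour a ≢ colour c
      colours-differ {a} {c} has hasn′t same = contradiction
        (trans (sym (dec-true (any? _) has)) (trans same (dec-false (any? _) hasn′t))) λ ()

      proper : ∀ a c → ComplAdj G a c → colour a ≢ colour c
      proper a c a≁c with <-cmp (K a) (K c)
      ... | tri< a<c _ _ = colours-differ (c , c∉a , a<c) (later-has-no-later-nonNbr c∉a a<c)
        where c∉a = complAdj⇒∉N[] a≁c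
      ... | tri≈ _ a≡c _ = ⊥-elim (proj₁ a≁c (rank-injective z′ a≡c))
      ... | tri> _ _ c<a = ≢-sym (colours-differ (a , a∉c , c<a) (later-has-no-later-nonNbr a∉c c<a))
        where a∉c = ∉N[]-sym (complAdj⇒∉N[] a≁c)

    record NestedNeighbourhoods : Set where
      field
        base u v     : Fin n
        α γ β        : ℕ
        0<α          : 0 < α
        γ<β          : γ < β
        1+β<n        : suc β < n
        N[v]-initial : ∀ w → w ∈N[ v ] ⇔ rank base w ≤ β
        N[u]-inside  : ∀ {w} → w ∈N[ u ] → α ≤ rank base w × rank base w ≤ γ
        v∈N[u]       : v ∈N[ u ]

      u≢v : u ≢ v
      u≢v u≡v = <⇒≱ 0<α (subst (α ≤_) (rank-self base) (proj₁ (N[u]-inside base∈N[u])))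
        where
        base∈N[u] : base ∈N[ u ]
        base∈N[u] = subst (base ∈N[_]) (sym u≡v)
          (from (N[v]-initial base) (subst (_≤ β) (sym (rank-self base)) z≤n))

    module Nested (cfg : NestedNeighbourhoods) where
      open NestedNeighbourhoods cfg

      private
        K : Fin n → ℕ
        K = rank base

      module _ (u<v : K u < K v) where
        private
          α≤Ku : α ≤ K u
          α≤Ku = proj₁ (N[u]-inside (self refl))

          Kv≤γ : K v ≤ γ
          Kv≤γ = proj₂ (N[u]-inside v∈N[u])

          α≤β : α ≤ β
          α≤β = ≤-trans α≤Ku (≤-trans (<⇒≤ u<v) (≤-trans Kv≤γ (<⇒≤ γ<β)))

          β<n : β < n
          β<n = <-trans (n<1+n β) 1+β<n

          base<α : K base < α
          base<α = subst (_< α) (sym (rank-self base)) 0<α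

        sees-v : ∀ {x} → K x ≤ β → v ∈N[ x ]
        sees-v {x} x≤β = ∈N[]-sym (from (N[v]-initial x) x≤β)

        misses-u : ∀ {x} → K x < α ⊎ γ < K x → u ∉N[ x ]
        misses-u x-outside u∈x with N[u]-inside (∈N[]-sym u∈x) | x-outside
        ... | α≤x , _ | inj₁ x<α = <⇒≱ x<α α≤x
        ... | _ , x≤γ | inj₂ γ<x = <⇒≱ γ<x x≤γ

        sees-from-v-onwards : ∀ {x a} → K a < K u → a ∈N[ x ] → K x ≤ β → u ∉N[ x ] →
          ∀ {w} → K v ≤ K w → w ∈N[ x ]
        sees-from-v-onwards {x} a<u a∈x x≤β u∉x {w} v≤w with m≤n⇒m<n∨m≡n v≤w
        ... | inj₂ Kv≡Kw = subst (_∈N[ x ]) (rank-injective base Kv≡Kw) (sees-v x≤β)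
        ... | inj₁ v<w   = nbhd-wraps base a<u u<v a∈x (sees-v x≤β) u∉x w (inj₂ v<w)

        left-flank-sees-from-v : ∀ {x} → K x < α → ∀ {w} → K v ≤ K w → w ∈N[ x ]
        left-flank-sees-from-v x<α =
          sees-from-v-onwards (<-≤-trans x<α α≤Ku) (self refl) (<⇒≤ (<-≤-trans x<α α≤β)) (misses-u (inj₁ x<α))

        right-flank-sees-from-v : ∀ {y} → γ < K y → K y ≤ β → ∀ {w} → K v ≤ K w → w ∈N[ y ]
        right-flank-sees-from-v γ<y y≤β = sees-from-v-onwards (<-≤-trans base<α α≤Ku)
          (∈N[]-sym (left-flank-sees-from-v base<α (≤-trans Kv≤γ (<⇒≤ γ<y)))) y≤β (misses-u (inj₂ γ<y))

        HasFarNonNbr : Fin n → Set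
        HasFarNonNbr z = ∃ λ t → β < K t × t ∉N[ z ]

        nonNbrs-of-middle-are-far : ∀ {z} → K v ≤ K z → K z ≤ γ → HasFarNonNbr z →
          ∀ {w} → w ∉N[ z ] → β < K w
        nonNbrs-of-middle-are-far {z} v≤z z≤γ (t , β<t , t∉z) {w} w∉z with rank-surjective base β<n
        ... | last , Klast≡β = ≰⇒> w-not-near
          where
          base∈z : base ∈N[ z ]
          base∈z = ∈N[]-sym (left-flank-sees-from-v base<α v≤z)

          last∈z : last ∈N[ z ]
          last∈z = ∈N[]-sym (right-flank-sees-from-v (subst (γ <_) (sym Klast≡β) γ<β) (≤-reflexive Klast≡β) v≤z)

          w-not-near : K w ≰ β
          w-not-near w≤β with K w ≟ 0 | m≤n⇒m<n∨m≡n w≤β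
          ... | yes Kw≡0 | _ =
            w∉z (subst (_∈N[ z ]) (rank-injective base (trans (rank-self base) (sym Kw≡0))) base∈z)
          ... | no _ | inj₂ Kw≡β =
            w∉z (subst (_∈N[ z ]) (rank-injective base (trans Klast≡β (sym Kw≡β))) last∈z)
          ... | no Kw≢0 | inj₁ w<β = t∉z (nbhd-wraps base
            (subst (_< K w) (sym (rank-self base)) (n≢0⇒n>0 Kw≢0)) (subst (K w <_) (sym Klast≡β) w<β)
            base∈z last∈z w∉z t (inj₂ (subst (_< K t) (sym Klast≡β) β<t)))

        v-has-far-nonNbr : HasFarNonNbr v
        v-has-far-nonNbr with rank-surjective base 1+β<n
        ... | t , Kt≡1+β = t , subst (β <_) (sym Kt≡1+β) ≤-refl ,
                           λ t∈v → 1+n≰n (subst (_≤ β) Kt≡1+β (to (N[v]-initial t) t∈v))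

        HasFarNonNbrAt : ℕ → Set
        HasFarNonNbrAt k = ∃ λ z → K z ≡ k × HasFarNonNbr z

        hasFarNonNbrAt? : ∀ k → Dec (HasFarNonNbrAt k)
        hasFarNonNbrAt? k = any? λ z → (K z ≟ k) ×-dec any? λ t → (β <? K t) ×-dec ¬? (t ∈N[ z ]?)

        -- z is the last vertex ranked between v and γ with a non-neighbour beyond β; z′ follows it.
        consecutive-dominating-pair : ∃₂ λ z z′ → suc (rank z′ z) ≡ n × (∀ w → w ∉N[ z ] → w ∉N[ z′ ] → ⊥)
        consecutive-dominating-pair
          with maximal-witness hasFarNonNbrAt? γ Kv≤γ (v , refl , v-has-far-nonNbr)
        ... | q , Kv≤q , q≤γ , (z , Kz≡q , z-far) , q-maximal
          with rank-surjective base (≤-<-trans (≤-trans (s≤s q≤γ) γ<β) β<n)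
        ... | z′ , Kz′≡1+q = z , z′ , rank-next⇒last (trans Kz′≡1+q (cong suc (sym Kz≡q))) , dominating
          where
          far : ∀ {w} → w ∉N[ z ] → β < K w
          far = nonNbrs-of-middle-are-far (subst (K v ≤_) (sym Kz≡q) Kv≤q) (subst (_≤ γ) (sym Kz≡q) q≤γ) z-far

          dominating : ∀ w → w ∉N[ z ] → w ∉N[ z′ ] → ⊥
          dominating w w∉z w∉z′ = [ z′-in-right-flank , no-far-nonNbr-after-z ]′ q-maximal
            where
            z′-in-right-flank : q ≡ γ → ⊥
            z′-in-right-flank q≡γ = w∉z′ (right-flank-sees-from-v (subst (γ <_) (sym Kz′≡1+γ) ≤-refl)
              (subst (_≤ β) (sym Kz′≡1+γ) γ<β) (≤-trans Kv≤γ (<⇒≤ (<-trans γ<β (far w∉z)))))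
              where
              Kz′≡1+γ : K z′ ≡ suc γ
              Kz′≡1+γ = trans Kz′≡1+q (cong suc q≡γ)

            no-far-nonNbr-after-z : ¬ HasFarNonNbrAt (suc q) → ⊥
            no-far-nonNbr-after-z ¬next = ¬next (z′ , Kz′≡1+q , w , far w∉z , w∉z′)

        bipartite-complement : IsBipartiteComplement G
        bipartite-complement with consecutive-dominating-pair
        ... | z , z′ , z-last , dominating = consecutive-dominating-pair⇒bipartite-complement z-last dominating

module ArcOrdering {n} {G : Graph n} {pos : Fin n → Fin n} (ordering : IsArcOrdering 𝒩[ G ] pos) where
  open ClosedNeighbourhoods G

  private
    pos-injective : Injective _≡_ _≡_ pos
    pos-injective = proj₁ ordering

  closedNbhd : Fin n → Subset n
  closedNbhd c w = isYes (w ∈N[ c ]?)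

  ∈closedNbhd⇔∈N[] : ∀ c w → w ∈ closedNbhd c ⇔ w ∈N[ c ]
  ∈closedNbhd⇔∈N[] c w = mk⇔ (toWitness {a? = w ∈N[ c ]?} ∘ from T-≡) (to T-≡ ∘ fromWitness {a? = w ∈N[ c ]?})

  closedNbhd-arc : ∀ c → ∃₂ λ s l → ∀ w → w ∈N[ c ] ⇔ offset n s (pos w) < l
  closedNbhd-arc c with proj₂ ordering (closedNbhd c) (c , ∈closedNbhd⇔∈N[] c)
  ... | s , l , _ , inArc = s , l , λ w → inArc w ⇔-∘ ⇔-sym (∈closedNbhd⇔∈N[] c w)

  forwardRanking : Ranking
  forwardRanking = record
    { rank           = λ b x → offset n (pos b) (pos x)
    ; rank<n         = λ b x → offset<n (pos b) (pos x)
    ; rank-self      = λ b → offset-self (pos b)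
    ; rank-injective = λ b → pos-injective ∘ offset-injectiveʳ (pos b)
    ; rank-trans     = λ b x y → offset-trans (pos b) (pos x) (pos y)
    ; nbhd-wraps     = λ b {c} {a} {m} {d} a<m m<d a∈c d∈c m∉c w outside →
        let s , l , inArc = closedNbhd-arc c in
        from (inArc w) (ForwardView.arc-wraps s (pos b) {l} {pos a} {pos m} {pos d} {pos w} a<m m<d
          (to (inArc a) a∈c) (to (inArc d) d∈c) (m∉c ∘ from (inArc m)) outside)
    }

  backwardRanking : Ranking
  backwardRanking = record
    { rank           = λ b x → offset n (pos x) (pos b)
    ; rank<n         = λ b x → offset<n (pos x) (pos b)
    ; rank-self      = λ b → offset-self (pos b)
    ; rank-injective = λ b → pos-injective ∘ offset-injectiveˡ (pos b)
    ; rank-trans     = λ b x y → subst (λ t → WrapsTo n t (offset n (pos y) (pos b)))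
                                   (+-comm (offset n (pos y) (pos x)) (offset n (pos x) (pos b)))
                                   (offset-trans (pos y) (pos x) (pos b))
    ; nbhd-wraps     = λ b {c} {a} {m} {d} a<m m<d a∈c d∈c m∉c w outside →
        let s , l , inArc = closedNbhd-arc c in
        from (inArc w) (BackwardView.arc-wraps s (pos b) {l} {pos a} {pos m} {pos d} {pos w} a<m m<d
          (to (inArc a) a∈c) (to (inArc d) d∈c) (m∉c ∘ from (inArc m)) outside)
    }

  open Ranking forwardRanking using (rank-surjective)

  -- Reading backwards from the last vertex of N[v] reflects the configuration, so that the
  -- order of u and v is reversed.
  module Mirror (cfg : NestedNeighbourhoods forwardRanking) where
    open NestedNeighbourhoods cfg

    private
      K : Fin n → ℕ
      K w = offset n (pos base) (pos w)

      lastOfN[v] : ∃ λ e → K e ≡ β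
      lastOfN[v] = rank-surjective base (<-trans (n<1+n β) 1+β<n)

      e : Fin n
      e = proj₁ lastOfN[v]

      K′ : Fin n → ℕ
      K′ w = offset n (pos w) (pos e)

      through : ∀ w → WrapsTo n (K w + K′ w) β
      through w = subst (WrapsTo n (K w + K′ w)) (proj₂ lastOfN[v]) (offset-trans (pos base) (pos w) (pos e))

      inside-N[u] : ∀ {w} → w ∈N[ u ] → K w ≤ β
      inside-N[u] w∈u = ≤-trans (proj₂ (N[u]-inside w∈u)) (<⇒≤ γ<β)

    mirrored-rank : ∀ {w} → K w ≤ β → K′ w ≡ β ∸ K w
    mirrored-rank {w} w≤β with through w
    ... | inj₁ eq = sym (trans (cong (_∸ K w) (sym eq)) (m+n∸m≡n (K w) (K′ w)))
    ... | inj₂ eq = contradiction eq (<⇒≢ (+-mono-≤-< w≤β (offset<n (pos w) (pos e))))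

    mirrored-≤ : ∀ {w} → K′ w ≤ β → K w ≤ β
    mirrored-≤ {w} w≤β with through w
    ... | inj₁ eq = subst (K w ≤_) eq (m≤m+n (K w) (K′ w))
    ... | inj₂ eq = contradiction eq (<⇒≢ (begin-strict
      K w + K′ w  <⟨ +-mono-<-≤ (offset<n (pos base) (pos w)) w≤β ⟩
      n + β       ≡⟨ +-comm n β ⟩
      β + n       ∎))
      where open ≤-Reasoning

    mirrored : NestedNeighbourhoods backwardRanking
    mirrored = record
      { base         = e
      ; u            = u
      ; v            = v
      ; α            = β ∸ γ
      ; γ            = β ∸ α
      ; β            = β
      ; 0<α          = m<n⇒0<n∸m γ<β
      ; γ<β          = ∸-monoʳ-< 0<α (≤-trans (proj₁ (N[u]-inside (self refl))) (inside-N[u] (self refl)))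
      ; 1+β<n        = 1+β<n
      ; N[v]-initial = λ w → mk⇔
          (λ w∈v → subst (_≤ β) (sym (mirrored-rank (to (N[v]-initial w) w∈v))) (m∸n≤m β (K w)))
          (from (N[v]-initial w) ∘ mirrored-≤)
      ; N[u]-inside  = λ w∈u → subst (β ∸ γ ≤_) (sym (mirrored-rank (inside-N[u] w∈u)))
                                  (∸-monoʳ-≤ β (proj₂ (N[u]-inside w∈u)))
                             , subst (_≤ β ∸ α) (sym (mirrored-rank (inside-N[u] w∈u)))
                                  (∸-monoʳ-≤ β (proj₁ (N[u]-inside w∈u)))
      ; v∈N[u]       = v∈N[u]
      }

    mirrored-order : K v < K u → K′ u < K′ v
    mirrored-order v<u = subst₂ _<_ (sym (mirrored-rank (inside-N[u] (self refl))))
      (sym (mirrored-rank (inside-N[u] v∈N[u]))) (∸-monoʳ-< v<u (inside-N[u] (self refl)))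

  nested⇒bipartite-complement : NestedNeighbourhoods forwardRanking → IsBipartiteComplement G
  nested⇒bipartite-complement cfg = by-order (<-cmp (K u) (K v))
    where
    open NestedNeighbourhoods cfg

    K : Fin n → ℕ
    K w = offset n (pos base) (pos w)

    by-order : Tri (K u < K v) (K u ≡ K v) (K v < K u) → IsBipartiteComplement G
    by-order (tri< u<v _ _)   = Nested.bipartite-complement forwardRanking cfg u<v
    by-order (tri≈ _ Ku≡Kv _) = ⊥-elim (u≢v (pos-injective (offset-injectiveʳ (pos base) Ku≡Kv)))
    by-order (tri> _ _ v<u)   =
      Nested.bipartite-complement backwardRanking (Mirror.mirrored cfg) (Mirror.mirrored-order cfg v<u)

  CommonEndpoint : Subset n → Subset n → Set
  CommonEndpoint A B = ∃[ x ] (IsEndpoint pos A x × IsEndpoint pos B x)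

  module NestedArcs {A B : Subset n} {a b : Fin n} {ℓ β : ℕ}
    (arcA : ArcAt pos A (pos a) (suc ℓ)) (arcB : ArcAt pos B (pos b) (suc β))
    (A⊆B : A ⊆ B) (1+β<n : suc β < n) where

    private
      K Fa : Fin n → ℕ
      K w  = offset n (pos b) (pos w)
      Fa w = offset n (pos a) (pos w)

      α : ℕ
      α = K a

      via-a : ∀ w → WrapsTo n (α + Fa w) (K w)
      via-a w = offset-trans (pos b) (pos a) (pos w)

      α<1+β : α < suc β
      α<1+β = to (proj₂ arcB a) (A⊆B a (from (proj₂ arcA a) (subst (_< suc ℓ) (sym (offset-self (pos a))) (s≤s z≤n))))

      unwrapped-after-α : ∀ {w} → α ≤ K w → α + Fa w ≡ K w
      unwrapped-after-α {w} α≤w with via-a w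
      ... | inj₁ eq = eq
      ... | inj₂ eq = contradiction α≤w (<⇒≱ (+-cancelʳ-< n (K w) α
                        (subst (_< α + n) eq (+-monoʳ-< α (offset<n (pos a) (pos w))))))

      α+1+ℓ≤1+β : α + suc ℓ ≤ suc β
      α+1+ℓ≤1+β with α + suc ℓ ≤? suc β | rank-surjective b 1+β<n
      ... | yes fits | _ = fits
      ... | no ¬fits | y , Ky≡1+β = contradiction (to (proj₂ arcB y) (A⊆B y y∈A)) (<-irrefl Ky≡1+β)
        where
        y∈A : y ∈ A
        y∈A = from (proj₂ arcA y) (+-cancelˡ-< α (Fa y) (suc ℓ)
          (subst (_< α + suc ℓ) (sym (trans (unwrapped-after-α (subst (α ≤_) (sym Ky≡1+β) (<⇒≤ α<1+β))) Ky≡1+β))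
            (≰⇒> ¬fits)))

      A-after-α : ∀ {w} → w ∈ A → α ≤ K w
      A-after-α {w} w∈A with via-a w
      ... | inj₁ eq = subst (α ≤_) eq (m≤m+n α (Fa w))
      ... | inj₂ eq = contradiction (begin-strict
        n            ≤⟨ m≤n+m n (K w) ⟩
        K w + n      ≡⟨ sym eq ⟩
        α + Fa w     <⟨ +-monoʳ-< α (to (proj₂ arcA w) w∈A) ⟩
        α + suc ℓ    ≤⟨ α+1+ℓ≤1+β ⟩
        suc β        <⟨ 1+β<n ⟩
        n            ∎) (<-irrefl refl)
        where open ≤-Reasoning

    first-endpoint : α ≡ 0 → CommonEndpoint A B
    first-endpoint α≡0 = a , (pos a , suc ℓ , arcA , s≤s z≤n , inj₁ (offset-self (pos a)))
                           , (pos b , suc β , arcB , s≤s z≤n , inj₁ α≡0)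

    last-endpoint : α + suc ℓ ≡ suc β → CommonEndpoint A B
    last-endpoint ends-together with rank-surjective b (<-trans (n<1+n β) 1+β<n)
    ... | e , Ke≡β = e , (pos a , suc ℓ , arcA , s≤s z≤n , inj₂ 1+Fa≡1+ℓ)
                       , (pos b , suc β , arcB , s≤s z≤n , inj₂ (cong suc Ke≡β))
      where
      1+Fa≡1+ℓ : suc (Fa e) ≡ suc ℓ
      1+Fa≡1+ℓ = +-cancelˡ-≡ α (suc (Fa e)) (suc ℓ) (begin
        α + suc (Fa e)  ≡⟨ +-suc α (Fa e) ⟩
        suc (α + Fa e)  ≡⟨ cong suc (unwrapped-after-α (subst (α ≤_) (sym Ke≡β) (s≤s⁻¹ α<1+β))) ⟩
        suc (K e)       ≡⟨ cong suc Ke≡β ⟩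
        suc β           ≡⟨ sym ends-together ⟩
        α + suc ℓ       ∎)
        where open ≡-Reasoning

    strictly-nested : 𝒩[ G ] A → 𝒩[ G ] B → 0 < α → α + suc ℓ < suc β → NestedNeighbourhoods forwardRanking
    strictly-nested (u , A≡N[u]) (v , B≡N[v]) 0<α short = record
      { base         = b
      ; u            = u
      ; v            = v
      ; α            = α
      ; γ            = α + ℓ
      ; β            = β
      ; 0<α          = 0<α
      ; γ<β          = s<s⁻¹ (subst (_< suc β) (+-suc α ℓ) short)
      ; 1+β<n        = 1+β<n
      ; N[v]-initial = λ w → mk⇔ (s≤s⁻¹ ∘ to (proj₂ arcB w) ∘ from (B≡N[v] w))
                                  (to (B≡N[v] w) ∘ from (proj₂ arcB w) ∘ s≤s)
      ; N[u]-inside  = λ {w} w∈u → N[u]-inside (from (A≡N[u] w) w∈u)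
      ; v∈N[u]       = ∈N[]-sym (to (B≡N[v] u) (A⊆B u (from (A≡N[u] u) (self refl))))
      }
      where
      N[u]-inside : ∀ {w} → w ∈ A → α ≤ K w × K w ≤ α + ℓ
      N[u]-inside {w} w∈A = A-after-α w∈A
        , subst (_≤ α + ℓ) (unwrapped-after-α (A-after-α w∈A)) (+-monoʳ-≤ α (s≤s⁻¹ (to (proj₂ arcA w) w∈A)))

    share-endpoint : ¬ IsBipartiteComplement G → 𝒩[ G ] A → 𝒩[ G ] B → CommonEndpoint A B
    share-endpoint coBip A∈𝒩 B∈𝒩 with α ≟ 0 | α + suc ℓ ≟ suc β
    ... | yes α≡0 | _                = first-endpoint α≡0
    ... | no _    | yes ends-together = last-endpoint ends-together
    ... | no α≢0  | no ¬ends-together = ⊥-elim (coBip (nested⇒bipartite-complement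
      (strictly-nested A∈𝒩 B∈𝒩 (n≢0⇒n>0 α≢0) (≤∧≢⇒< α+1+ℓ≤1+β ¬ends-together))))

  nested-hyperedges-share-endpoint : ¬ IsBipartiteComplement G → ∀ {A B} → 𝒩[ G ] A → 𝒩[ G ] B →
    Nonempty A → A ⊆ B → ¬ IsFull B → IsArc pos A → IsArc pos B → CommonEndpoint A B
  nested-hyperedges-share-endpoint coBip {A} {B} A∈𝒩 B∈𝒩 (x , x∈A) A⊆B B≢V (sA , _ , arcA) (sB , _ , arcB)
    with injective⇒surjective pos-injective sA | injective⇒surjective pos-injective sB
  ... | a , refl | b , refl = by-length arcA arcB
    where
    by-length : ∀ {lA lB} → ArcAt pos A (pos a) lA → ArcAt pos B (pos b) lB → CommonEndpoint A B
    by-length {zero}              (_ , inA) _         = contradiction (to (inA x) x∈A) λ ()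
    by-length {suc _} {zero}      _         (_ , inB) = contradiction (to (inB x) (A⊆B x x∈A)) λ ()
    by-length {suc _} {suc β}     arcA′     arcB′     =
      NestedArcs.share-endpoint arcA′ arcB′ A⊆B 1+β<n coBip A∈𝒩 B∈𝒩
      where
      1+β<n : suc β < n
      1+β<n = ≤∧≢⇒< (proj₁ arcB′) λ 1+β≡n → B≢V λ w →
        from (proj₂ arcB′ w) (subst (offset n (pos b) (pos w) <_) (sym 1+β≡n) (offset<n (pos b) (pos w)))

lemma3p4 : ∀ {n : ℕ} (G : Graph n) → IsPCA G → ¬ IsBipartiteComplement G →
    ∀ (pos : Fin n → Fin n) → IsArcOrdering 𝒩[ G ] pos → IsTight 𝒩[ G ] pos
lemma3p4 G _ coBip pos ordering A B A∈𝒩 B∈𝒩 A≢∅ A⊆B B≢V =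
  ArcOrdering.nested-hyperedges-share-endpoint ordering coBip A∈𝒩 B∈𝒩 A≢∅ A⊆B B≢V
    (proj₂ ordering A A∈𝒩) (proj₂ ordering B B∈𝒩)
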